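{- Let $U$ be a $2$-cuttable unrooted binary phylogenetic network on $X$, and let $e$ and $e'$ be distinct cut-edges of $U$. Then the splits induced by $e$ and $e'$ are distinct.
   Context: An unrooted binary phylogenetic network on a non-empty finite set $X$ is a simple connected undirected graph whose internal vertices have degree $3$ and whose degree-$1$ vertices (leaves) are bijectively labeled by $X$. A cut-edge is an edge whose deletion disconnects the graph. $U$ is $2$-cuttable if every cycle contains a path of at least $2$ vertices each incident to a cut-edge. An $X$-split $X_1|X_2$ is a partition of $X$ into two non-empty sets; a cut-edge $e$ induces $X_1|X_2$ if $X_1|X_2$ is an $X$-split and every path in $U$ between a leaf in $X_1$ and a leaf in $X_2$ passes through $e$ (in a $2$-cuttable network every cut-edge induces a split). -}

module Defs where

open import Data.Nat using (ℕ; _≤_; _<_)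
open import Data.Fin using (Fin)
open import Data.Bool using (Bool; true; false; T; not)
open import Data.List using (List; []; _∷_; length; filterᵇ; take; drop; _++_)
open import Data.List.Relation.Unary.All using (All)
open import Data.List.Relation.Unary.Unique.Propositional using (Unique)
open import Data.Product using (Σ; ∃; ∃-syntax; _×_; _,_)
open import Data.Sum using (_⊎_)
open import Relation.Nullary using (¬_)
open import Relation.Binary.PropositionalEquality using (_≡_)
open import Function.Definitions using (Injective)
open import Data.Fin using () renaming (_≟_ to _≟ᶠ_)

allV : (n : ℕ) → List (Fin n)
allV n = Data.List.allFin n

record Graph (n : ℕ) : Set where
  field
    adj     : Fin n → Fin n → Bool
    adj-sym : ∀ u v → adj u v ≡ adj v u
    loopless : ∀ v → adj v v ≡ false

module _ {n : ℕ} (G : Graph n) where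
  open Graph G

  degree : Fin n → ℕ
  degree v = length (filterᵇ (adj v) (allV n))

  data WalkR (R : Fin n → Fin n → Set) : Fin n → Fin n → List (Fin n) → Set where
    here : ∀ {x} → WalkR R x x (x ∷ [])
    step : ∀ {x y z vs} → R x y → WalkR R y z vs → WalkR R x z (x ∷ vs)

  Adj : Fin n → Fin n → Set
  Adj u v = T (adj u v)

  Walk : Fin n → Fin n → List (Fin n) → Set
  Walk = WalkR Adj

  Path : Fin n → Fin n → List (Fin n) → Set
  Path x y vs = Walk x y vs × Unique vs

  Connected : Set
  Connected = ∀ x y → ∃[ vs ] Walk x y vs

  -- edges, as ordered representatives of unordered edges {u , v}
  record Edge : Set where
    constructor edge
    field
      u v : Fin n
      uv  : Adj u v

  SameEdge : Edge → Edge → Set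
  SameEdge (edge a b _) (edge c d _) = (a ≡ c × b ≡ d) ⊎ (a ≡ d × b ≡ c)

  AdjMinus : Edge → Fin n → Fin n → Set
  AdjMinus (edge a b _) x y = Adj x y × ¬ ((x ≡ a × y ≡ b) ⊎ (x ≡ b × y ≡ a))

  IsCutEdge : Edge → Set
  IsCutEdge e = ∃[ x ] ∃[ y ] ¬ (∃[ vs ] WalkR (AdjMinus e) x y vs)

  data Consec (a b : Fin n) : List (Fin n) → Set where
    now   : ∀ {vs} → Consec a b (a ∷ b ∷ vs)
    later : ∀ {c vs} → Consec a b vs → Consec a b (c ∷ vs)

  PassesThrough : Edge → List (Fin n) → Set
  PassesThrough (edge a b _) vs = Consec a b vs ⊎ Consec b a vs

  IsCycle : List (Fin n) → Set
  IsCycle cs = Σ (Fin n) λ x → Σ (Fin n) λ y →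
    Walk x y cs × Adj y x × 3 ≤ length cs × Unique cs

  IncidentToCutEdge : Fin n → Set
  IncidentToCutEdge v = ∃[ w ] Σ (Adj v w) λ p → IsCutEdge (edge v w p)

  rotate : ℕ → List (Fin n) → List (Fin n)
  rotate i cs = drop i cs ++ take i cs

  -- the cycle cs contains a path (a contiguous cyclic segment) of at least
  -- 2 vertices, each incident to a cut-edge
  HasCutSegment : List (Fin n) → Set
  HasCutSegment cs = ∃[ i ] ∃[ k ]
    i < length cs × 2 ≤ k × k ≤ length cs ×
    All IncidentToCutEdge (take k (rotate i cs))

  TwoCuttableGraph : Set
  TwoCuttableGraph = ∀ cs → IsCycle cs → HasCutSegment cs

record Network (m : ℕ) : Set where
  field
    n         : ℕ
    graph     : Graph n
    nonempty  : 1 ≤ m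
    connected : Connected graph
    deg13     : ∀ v → degree graph v ≡ 1 ⊎ degree graph v ≡ 3
    leaf      : Fin m → Fin n
    leaf-inj  : Injective _≡_ _≡_ leaf
    leaf-deg  : ∀ i → degree graph (leaf i) ≡ 1
    leaf-surj : ∀ v → degree graph v ≡ 1 → ∃[ i ] leaf i ≡ v

module _ {m : ℕ} (U : Network m) where
  open Network U

  Cut : Set
  Cut = Edge graph

  TwoCuttable : Set
  TwoCuttable = TwoCuttableGraph graph

  CutEdge : Cut → Set
  CutEdge = IsCutEdge graph

  -- an X-split X₁ | X₂ represented by the characteristic function of X₁
  IsSplit : (Fin m → Bool) → Set
  IsSplit A = (∃[ i ] A i ≡ true) × (∃[ j ] A j ≡ false)

  Induces : Cut → (Fin m → Bool) → Set
  Induces e A = IsSplit A ×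
    (∀ x y → A x ≡ true → A y ≡ false →
      ∀ vs → Path graph (leaf x) (leaf y) vs → PassesThrough graph e vs)

-- equality of splits (unordered: X₁|X₂ = X₂|X₁)
SameSplit : {m : ℕ} → (Fin m → Bool) → (Fin m → Bool) → Set
SameSplit A B = (∀ i → A i ≡ B i) ⊎ (∀ i → A i ≡ not (B i))

{-# OPTIONS --safe #-}
-- Suppose the distinct cut-edges e and e′ induce the same split. Both lie on the path
-- between two leaves on opposite sides, in the order s ⇝ a → b ⇝ c → d ⇝ t say, and it
-- suffices to find a leaf ℓ between them: ℓ lies on t's side of ab but on s's side of cd.
-- Grow a simple path from c through b, avoiding a and d, until its head is a leaf. If the
-- two further neighbours of the head are already on the path, they close two nested
-- cycles; two-cuttability gives a vertex w ≠ b of the inner one with a cut-edge wq, and the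
-- outer cycle keeps q off the path. The same search behind wq, which is strictly smaller,
-- finds a leaf there, and that leaf is still between e and e′.
module Submission where

open import Defs
open import Data.Nat using (ℕ; zero; suc; _+_; _≤_; _<_; z≤n; s≤s)
open import Data.Nat.Properties using (+-suc; +-identityʳ; ≤-trans; ≤-refl; <⇒≱; m≤n+m; m≤m+n; +-monoˡ-≤)
open import Data.Fin using (Fin; _≟_)
open import Data.Bool using (Bool; true; false; T; not)
open import Data.Bool.Properties using (not-involutive)
open import Data.List using (List; []; _∷_; _++_; length; allFin; drop; take; [_]; filterᵇ)
open import Data.List.Properties using (++-assoc; length-++; length-tabulate; take++drop≡id)
open import Data.List.Relation.Unary.Any using (here; there)
open import Data.List.Relation.Unary.All using (All; []; _∷_)
open import Data.List.Relation.Unary.All.Properties using (¬Any⇒All¬; All¬⇒¬Any; ++⁻ˡ; ++⁻ʳ)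
open import Data.List.Relation.Unary.AllPairs using ([]; _∷_)
open import Data.List.Relation.Unary.Unique.Propositional using (Unique)
open import Data.List.Relation.Unary.Unique.Propositional.Properties
  using (Unique[x∷xs]⇒x∉xs; filter⁺; allFin⁺; ++⁺)
open import Data.List.Membership.Propositional using (_∈_; _∉_)
open import Data.List.Membership.Propositional.Properties
  using (∈-++⁺ˡ; ∈-++⁺ʳ; ∈-++⁻; ∈-∃++; ∈-allFin; ∈-filter⁺; ∈-filter⁻)
open import Data.List.Relation.Binary.Subset.Propositional using (_⊆_)
open import Data.Product using (∃-syntax; ∃₂; _×_; _,_; proj₁; proj₂)
open import Data.Sum using (_⊎_; inj₁; inj₂; [_,_]′)
open import Data.Empty using (⊥-elim)
open import Function using (_∘_; id)
open import Relation.Nullary using (¬_; Dec; yes; no)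
open import Relation.Nullary.Decidable using (_×-dec_; _⊎-dec_; T?)
open import Relation.Binary.PropositionalEquality using (_≡_; _≢_; refl; sym; trans; cong; subst)

module _ {A : Set} where

  ∷-unique : ∀ {x : A} {xs} → x ∉ xs → Unique xs → Unique (x ∷ xs)
  ∷-unique x∉xs u = ¬Any⇒All¬ _ x∉xs ∷ u

  Unique-++⁻ˡ : ∀ (xs : List A) {ys} → Unique (xs ++ ys) → Unique xs
  Unique-++⁻ˡ []       _        = []
  Unique-++⁻ˡ (x ∷ xs) (x∉ ∷ u) = ++⁻ˡ xs x∉ ∷ Unique-++⁻ˡ xs u

  Unique-++⁻ʳ : ∀ (xs : List A) {ys} → Unique (xs ++ ys) → Unique ys
  Unique-++⁻ʳ []       u       = u
  Unique-++⁻ʳ (x ∷ xs) (_ ∷ u) = Unique-++⁻ʳ xs u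

  Unique-++-disjoint : ∀ (xs : List A) {ys v} → Unique (xs ++ ys) → v ∈ xs → v ∉ ys
  Unique-++-disjoint (x ∷ xs) (x∉ ∷ _) (here refl) = All¬⇒¬Any (++⁻ʳ xs x∉)
  Unique-++-disjoint (x ∷ xs) (_ ∷ u)  (there v∈)  = Unique-++-disjoint xs u v∈

  ∉-∷ : ∀ {x y : A} {ys} → x ≢ y → x ∉ ys → x ∉ y ∷ ys
  ∉-∷ x≢y _    (here x≡y)  = x≢y x≡y
  ∉-∷ _   x∉ys (there x∈) = x∉ys x∈

  ∈-split : ∀ (γ : List A) {v δ u} → u ∈ γ ++ v ∷ δ → u ∈ γ ++ [ v ] ⊎ u ∈ v ∷ δ
  ∈-split γ u∈ with ∈-++⁻ γ u∈
  ... | inj₁ u∈γ  = inj₁ (∈-++⁺ˡ u∈γ)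
  ... | inj₂ u∈vδ = inj₂ u∈vδ

  ∈-prefix : ∀ (γ : List A) {v δ u} → u ∈ γ ++ [ v ] → u ∈ γ ++ v ∷ δ
  ∈-prefix γ u∈ with ∈-++⁻ γ u∈
  ... | inj₁ u∈γ         = ∈-++⁺ˡ u∈γ
  ... | inj₂ (here refl) = ∈-++⁺ʳ γ (here refl)

  Unique-split : ∀ (γ : List A) {v δ} → Unique (γ ++ v ∷ δ) →
                 Unique (γ ++ [ v ]) × Unique (v ∷ δ) × (∀ {u} → u ∈ γ ++ [ v ] → u ∈ v ∷ δ → u ≡ v)
  Unique-split γ {v} {δ} u = Unique-++⁻ˡ (γ ++ [ v ]) (subst Unique (sym (++-assoc γ [ v ] δ)) u)
                           , Unique-++⁻ʳ γ u
                           , shared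
    where
    shared : ∀ {w} → w ∈ γ ++ [ v ] → w ∈ v ∷ δ → w ≡ v
    shared w∈ w∈vδ with ∈-++⁻ γ w∈
    ... | inj₁ w∈γ        = ⊥-elim (Unique-++-disjoint γ u w∈γ w∈vδ)
    ... | inj₂ (here w≡v) = w≡v

  first-of : ∀ {u v : A} L → u ∈ L → v ∈ L → u ≢ v →
             ∃₂ λ α β → (L ≡ α ++ u ∷ β × v ∈ β) ⊎ (L ≡ α ++ v ∷ β × u ∈ β)
  first-of (x ∷ L) (here refl) (here refl) u≢v = ⊥-elim (u≢v refl)
  first-of (x ∷ L) (here refl) (there v∈)  _   = [] , L , inj₁ (refl , v∈)
  first-of (x ∷ L) (there u∈)  (here refl) _   = [] , L , inj₂ (refl , u∈)
  first-of (x ∷ L) (there u∈)  (there v∈)  u≢v with first-of L u∈ v∈ u≢v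
  ... | α , β , inj₁ (refl , v∈β) = x ∷ α , β , inj₁ (refl , v∈β)
  ... | α , β , inj₂ (refl , u∈β) = x ∷ α , β , inj₂ (refl , u∈β)

  <-step : ∀ {k} (xs : List A) {y ys} f → k < length xs + suc f → k < length (xs ++ y ∷ ys) + f
  <-step {k} xs {y} {ys} f k< = ≤-trans (subst (k <_) (+-suc (length xs) f) k<) (+-monoˡ-≤ f longer)
    where
    longer : suc (length xs) ≤ length (xs ++ y ∷ ys)
    longer = subst (suc (length xs) ≤_) (sym (trans (length-++ xs) (+-suc (length xs) (length ys))))
                   (s≤s (m≤m+n (length xs) (length ys)))

  unique⊆⇒length≤ : ∀ {xs ys : List A} → Unique xs → xs ⊆ ys → length xs ≤ length ys
  unique⊆⇒length≤ {[]}     _        _   = z≤n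
  unique⊆⇒length≤ {x ∷ xs} (x∉ ∷ u) xs⊆ with ∈-∃++ (xs⊆ (here refl))
  ... | pre , post , refl = subst (suc (length xs) ≤_) (sym length-middle)
                              (s≤s (unique⊆⇒length≤ u shrink))
    where
    length-middle : length (pre ++ x ∷ post) ≡ suc (length (pre ++ post))
    length-middle = trans (length-++ pre)
                          (trans (+-suc (length pre) (length post)) (cong suc (sym (length-++ pre))))
    shrink : xs ⊆ pre ++ post
    shrink {v} v∈xs with ∈-++⁻ pre (xs⊆ (there v∈xs))
    ... | inj₁ v∈pre          = ∈-++⁺ˡ v∈pre
    ... | inj₂ (here refl)    = ⊥-elim (All¬⇒¬Any x∉ v∈xs)
    ... | inj₂ (there v∈post) = ∈-++⁺ʳ pre v∈post

module Graphs {n : ℕ} (g : Graph n) where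

  open import Data.List.Membership.DecPropositional (_≟_ {n}) using (_∈?_)

  V : Set
  V = Fin n

  Rel : Set₁
  Rel = V → V → Set

  Reach : Rel → V → V → Set
  Reach R s t = ∃[ L ] WalkR g R s t L

  module _ {R : Rel} where

    source∈ : ∀ {s t L} → WalkR g R s t L → s ∈ L
    source∈ here       = here refl
    source∈ (step _ _) = here refl

    target∈ : ∀ {s t L} → WalkR g R s t L → t ∈ L
    target∈ here       = here refl
    target∈ (step _ w) = there (target∈ w)

    reach-refl : ∀ {s} → Reach R s s
    reach-refl = _ , here

    _▸_ : ∀ {s t u} → R s t → Reach R t u → Reach R s u
    r ▸ (_ , w) = _ , step r w

    reach-trans : ∀ {s t u} → Reach R s t → Reach R t u → Reach R s u
    reach-trans (_ , here)     r₂ = r₂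
    reach-trans (_ , step r w) r₂ = r ▸ reach-trans (_ , w) r₂

    reach-sym : (∀ {x y} → R x y → R y x) → ∀ {s t} → Reach R s t → Reach R t s
    reach-sym sym-R (_ , here)     = reach-refl
    reach-sym sym-R (_ , step r w) = reach-trans (reach-sym sym-R (_ , w)) (sym-R r ▸ reach-refl)

    suffix : ∀ {s t v L} → WalkR g R s t L → v ∈ L →
             ∃₂ λ pre L′ → L ≡ pre ++ L′ × WalkR g R v t L′
    suffix here       (here refl) = [] , _ , refl , here
    suffix (step r w) (here refl) = [] , _ , refl , step r w
    suffix (step _ w) (there v∈)  with suffix w v∈
    ... | pre , L′ , refl , w′ = _ ∷ pre , L′ , refl , w′

    reach-within : (∀ {x y} → R x y → R y x) → ∀ {s t u v L} → WalkR g R s t L →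
                   u ∈ L → v ∈ L → Reach R u v
    reach-within sym-R w u∈ v∈ with suffix w u∈ | suffix w v∈
    ... | _ , _ , _ , wu | _ , _ , _ , wv = reach-trans (_ , wu) (reach-sym sym-R (_ , wv))

    source≡head : ∀ {s t x L} → WalkR g R s t (x ∷ L) → s ≡ x
    source≡head here       = refl
    source≡head (step _ _) = refl

    same-source : ∀ {s s′ t t′ L} → WalkR g R s t L → WalkR g R s′ t′ L → s ≡ s′
    same-source here       here       = refl
    same-source here       (step _ _) = refl
    same-source (step _ _) here       = refl
    same-source (step _ _) (step _ _) = refl

    walk-tail : ∀ {s t x y L} → WalkR g R s t (x ∷ y ∷ L) → WalkR g R y t (y ∷ L)
    walk-tail (step r here)       = here
    walk-tail (step r (step r′ w)) = step r′ w

    split-walk : ∀ γ {s t v δ} → WalkR g R s t (γ ++ v ∷ δ) →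
                 WalkR g R s v (γ ++ [ v ]) × WalkR g R v t (v ∷ δ)
    split-walk []      here       = here , here
    split-walk []      (step r w) = here , step r w
    split-walk (_ ∷ [])    (step r w) = step r (proj₁ (split-walk [] w)) , proj₂ (split-walk [] w)
    split-walk (_ ∷ _ ∷ γ) (step r w) = step r (proj₁ (split-walk (_ ∷ γ) w)) , proj₂ (split-walk (_ ∷ γ) w)

    to-path : ∀ {s t L} → WalkR g R s t L → ∃[ L′ ] WalkR g R s t L′ × Unique L′
    to-path here = _ , here , [] ∷ []
    to-path {s} (step r w) with to-path w
    ... | L , w′ , u with s ∈? L
    ...   | no s∉L = s ∷ L , step r w′ , ∷-unique s∉L u
    ...   | yes s∈L with suffix w′ s∈L
    ...     | pre , L′ , refl , w″ = L′ , w″ , Unique-++⁻ʳ pre u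

  map-walk : ∀ {R R′ : Rel} → (∀ {x y} → R x y → R′ x y) → ∀ {s t L} → WalkR g R s t L → WalkR g R′ s t L
  map-walk f here       = here
  map-walk f (step r w) = step (f r) (map-walk f w)

  open Graph g using (adj-sym; loopless)

  infix 4 _~_
  _~_ : Rel
  _~_ = Adj g

  ~-sym : ∀ {u v} → u ~ v → v ~ u
  ~-sym {u} {v} = subst T (adj-sym u v)

  ~⇒≢ : ∀ {u v} → u ~ v → u ≢ v
  ~⇒≢ {u} u~u refl = subst T (loopless u) u~u

  SameEnds : V → V → V → V → Set
  SameEnds a b x y = (x ≡ a × y ≡ b) ⊎ (x ≡ b × y ≡ a)

  -- Definitionally AdjMinus g (edge a b _), in terms of which IsCutEdge is stated.
  Adj∖ : V → V → Rel
  Adj∖ a b x y = x ~ y × ¬ SameEnds a b x y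

  Connected∖ : V → V → V → V → Set
  Connected∖ a b = Reach (Adj∖ a b)

  Bridge : V → V → Set
  Bridge a b = ¬ Connected∖ a b a b

  SameEnds-flip : ∀ {a b x y} → SameEnds a b x y → SameEnds a b y x
  SameEnds-flip (inj₁ (x≡a , y≡b)) = inj₂ (y≡b , x≡a)
  SameEnds-flip (inj₂ (x≡b , y≡a)) = inj₁ (y≡a , x≡b)

  SameEnds-swap : ∀ {a b x y} → SameEnds a b x y → SameEnds b a x y
  SameEnds-swap (inj₁ e) = inj₂ e
  SameEnds-swap (inj₂ e) = inj₁ e

  Adj∖-sym : ∀ {a b x y} → Adj∖ a b x y → Adj∖ a b y x
  Adj∖-sym (x~y , ¬e) = ~-sym x~y , ¬e ∘ SameEnds-flip

  Adj∖-swap : ∀ {a b x y} → Adj∖ a b x y → Adj∖ b a x y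
  Adj∖-swap (x~y , ¬e) = x~y , ¬e ∘ SameEnds-swap

  Connected∖-sym : ∀ {a b s t} → Connected∖ a b s t → Connected∖ a b t s
  Connected∖-sym = reach-sym Adj∖-sym

  Connected∖-swap : ∀ {a b s t} → Connected∖ a b s t → Connected∖ b a s t
  Connected∖-swap (_ , w) = _ , map-walk Adj∖-swap w

  Connected∖-transport : ∀ {a b p q s t} → SameEnds a b p q → Connected∖ p q s t → Connected∖ a b s t
  Connected∖-transport (inj₁ (refl , refl)) = id
  Connected∖-transport (inj₂ (refl , refl)) = Connected∖-swap

  Bridge-sym : ∀ {a b} → Bridge a b → Bridge b a
  Bridge-sym ab = ab ∘ Connected∖-sym ∘ Connected∖-swap

  Bridge-transport : ∀ {a b p q} → SameEnds a b p q → Bridge a b → Bridge p q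
  Bridge-transport (inj₁ (refl , refl)) = id
  Bridge-transport (inj₂ (refl , refl)) = Bridge-sym

  avoidˡ : ∀ {a b s t L} → Walk g s t L → a ∉ L → WalkR g (Adj∖ a b) s t L
  avoidˡ here       _   = here
  avoidˡ (step r w) a∉L = step (r , ends) (avoidˡ w (a∉L ∘ there))
    where
    ends : ¬ SameEnds _ _ _ _
    ends (inj₁ (refl , _)) = a∉L (here refl)
    ends (inj₂ (_ , refl)) = a∉L (there (source∈ w))

  avoidʳ : ∀ {a b s t L} → Walk g s t L → b ∉ L → WalkR g (Adj∖ a b) s t L
  avoidʳ w b∉L = map-walk Adj∖-swap (avoidˡ w b∉L)

  withinˡ : ∀ {a b s t u v L} → Walk g s t L → a ∉ L → u ∈ L → v ∈ L → Connected∖ a b u v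
  withinˡ w a∉L = reach-within Adj∖-sym (avoidˡ w a∉L)

  withinʳ : ∀ {a b s t u v L} → Walk g s t L → b ∉ L → u ∈ L → v ∈ L → Connected∖ a b u v
  withinʳ w b∉L u∈L v∈L = Connected∖-swap (withinˡ w b∉L u∈L v∈L)

  consec? : ∀ a b L → Dec (Consec g a b L)
  consec? a b []          = no λ ()
  consec? a b (x ∷ [])    = no λ { (later ()) }
  consec? a b (x ∷ y ∷ L) with x ≟ a | y ≟ b | consec? a b (y ∷ L)
  ... | yes refl | yes refl | _     = yes now
  ... | _        | _        | yes c = yes (later c)
  ... | no x≢a   | _        | no ¬c = no λ { now → x≢a refl ; (later c) → ¬c c }
  ... | yes _    | no y≢b   | no ¬c = no λ { now → y≢b refl ; (later c) → ¬c c }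

  consec-split : ∀ {x y L} → Consec g x y L → ∃₂ λ γ δ → L ≡ γ ++ x ∷ y ∷ δ
  consec-split now       = [] , _ , refl
  consec-split (later c) with consec-split c
  ... | γ , δ , refl = _ ∷ γ , δ , refl

  consec-∈ : ∀ {x y L} → Consec g x y L → x ∈ L × y ∈ L
  consec-∈ now       = here refl , there (here refl)
  consec-∈ (later c) with consec-∈ c
  ... | x∈ , y∈ = there x∈ , there y∈

  consec-adj : ∀ {R s t x y L} → WalkR g R s t L → Consec g x y L → R x y
  consec-adj (step r here)       now       = r
  consec-adj (step r (step _ _)) now       = r
  consec-adj (step _ w)          (later c) = consec-adj w c

  avoiding⇒¬consec : ∀ {a b s t x y L} → WalkR g (Adj∖ a b) s t L → SameEnds a b x y → ¬ Consec g x y L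
  avoiding⇒¬consec w ends c = proj₂ (consec-adj w c) ends

  ¬consec⇒avoiding : ∀ {a b s t L} → Walk g s t L →
                     (∀ {x y} → SameEnds a b x y → ¬ Consec g x y L) → WalkR g (Adj∖ a b) s t L
  ¬consec⇒avoiding here       _  = here
  ¬consec⇒avoiding (step r w) ¬c = step (r , λ ends → ¬c ends (first w))
                                        (¬consec⇒avoiding w λ ends → ¬c ends ∘ later)
    where
    first : ∀ {x y t L} → Walk g y t L → Consec g x y (x ∷ L)
    first here       = now
    first (step _ _) = now

  cut-edge⇒bridge : Connected g → ∀ {a b} (a~b : a ~ b) → IsCutEdge g (edge a b a~b) → Bridge a b
  cut-edge⇒bridge conn {a} {b} _ (x , y , disconnected) a⇝b = disconnected (reroute (proj₂ (conn x y)))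
    where
    reroute-step : ∀ {u v} → u ~ v → Connected∖ a b u v
    reroute-step {u} {v} u~v with (u ≟ a ×-dec v ≟ b) ⊎-dec (u ≟ b ×-dec v ≟ a)
    ... | yes (inj₁ (refl , refl)) = a⇝b
    ... | yes (inj₂ (refl , refl)) = Connected∖-sym a⇝b
    ... | no ¬ends                 = (u~v , ¬ends) ▸ reach-refl
    reroute : ∀ {u v L} → Walk g u v L → Connected∖ a b u v
    reroute here       = reach-refl
    reroute (step r w) = reach-trans (reroute-step r) (reroute w)

  bridge-sole-neighbour : ∀ {c d u s t L} → Bridge c d → Walk g s t L → c ∉ L → d ∈ L → u ∈ L →
                          c ~ u → u ≡ d
  bridge-sole-neighbour {c} {d} {u} {L = L} cd w c∉L d∈L u∈L c~u with u ≟ d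
  ... | yes u≡d = u≡d
  ... | no u≢d  = ⊥-elim (cd ((c~u , ends) ▸ withinˡ w c∉L u∈L d∈L))
    where
    ends : ¬ SameEnds c d c u
    ends (inj₁ (_ , u≡d)) = u≢d u≡d
    ends (inj₂ (c≡d , _)) = c∉L (subst (_∈ L) (sym c≡d) d∈L)

  beyond-bridge : ∀ {c d w q s y o L} → Walk g s y L → w ∈ L → q ∉ L → w ~ q → Bridge w q →
                  c ∉ L → d ∈ L → q ≢ c → Connected∖ w q q o → Connected∖ c d y o
  beyond-bridge {c} {d} {w} {q} {L = L} walk w∈L q∉L w~q wq c∉L d∈L q≢c (L′ , q⇝o) =
    reach-trans (withinˡ walk c∉L (target∈ walk) w∈L)
                ((w~q , ends) ▸ (L′ , avoidʳ (map-walk proj₁ q⇝o) d∉L′))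
    where
    ends : ¬ SameEnds c d w q
    ends (inj₁ (w≡c , _)) = c∉L (subst (_∈ L) w≡c w∈L)
    ends (inj₂ (_ , q≡c)) = q≢c q≡c
    d∉L′ : d ∉ L′
    d∉L′ d∈L′ = wq (Connected∖-sym (reach-trans (reach-within Adj∖-sym q⇝o (source∈ q⇝o) d∈L′)
                                                (withinʳ walk q∉L d∈L w∈L)))

  chord-cycle : ∀ xs {s t v ys} → Walk g s t (xs ++ v ∷ ys) → Unique (xs ++ v ∷ ys) → v ~ s →
                2 ≤ length xs → IsCycle g (xs ++ [ v ])
  chord-cycle xs walk uniq v~s len =
    _ , _ , proj₁ (split-walk xs walk) , v~s ,
    subst (3 ≤_) (sym (length-++ xs)) (+-monoˡ-≤ 1 len) , proj₁ (Unique-split xs uniq)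

  -- Go round the other way, v ⇝ t → s ⇝ u; the closing edge is not uv as C has ≥ 3 vertices.
  cycle-edge : ∀ {C u v} → IsCycle g C → Consec g u v C → Connected∖ u v u v
  cycle-edge {u = u} {v} (s , t , walk , t~s , len , uniq) c with consec-split c
  ... | γ , δ , refl =
    Connected∖-sym (reach-trans (_ , avoidˡ v⇝t u∉vδ) ((t~s , closing) ▸ (_ , avoidʳ s⇝u v∉γu)))
    where
    s⇝u = proj₁ (split-walk γ walk)
    v⇝t = walk-tail (proj₂ (split-walk γ walk))
    u∉vδ : u ∉ v ∷ δ
    u∉vδ = Unique[x∷xs]⇒x∉xs (proj₁ (proj₂ (Unique-split γ uniq)))
    v∉γu : v ∉ γ ++ [ u ]
    v∉γu v∈ = u∉vδ (here (sym (proj₂ (proj₂ (Unique-split γ uniq)) v∈ (there (here refl)))))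
    not-both : ∀ γ δ → Walk g s t (γ ++ u ∷ v ∷ δ) → Unique (γ ++ u ∷ v ∷ δ) →
               3 ≤ length (γ ++ u ∷ v ∷ δ) → t ≢ v ⊎ s ≢ u
    not-both []      []      _ _                   (s≤s (s≤s ()))
    not-both []      (_ ∷ _) w (_ ∷ (v∉ ∷ _)) _    =
      inj₁ λ { refl → All¬⇒¬Any v∉ (target∈ (walk-tail (walk-tail w))) }
    not-both (_ ∷ γ) _       w (x∉ ∷ _) _          =
      inj₂ λ { refl → All¬⇒¬Any x∉ (subst (_∈ γ ++ _) (source≡head w) (∈-++⁺ʳ γ (here refl))) }
    closing : ¬ SameEnds u v t s
    closing (inj₁ (refl , _))     = u∉vδ (target∈ v⇝t)
    closing (inj₂ (t≡v , s≡u)) with not-both γ δ walk uniq len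
    ... | inj₁ t≢v = t≢v t≡v
    ... | inj₂ s≢u = s≢u s≡u

  cycle-connected∖ : ∀ {C u v} → IsCycle g C → u ∈ C → v ∈ C → Connected∖ u v u v
  cycle-connected∖ {C} {u} {v} cyc@(_ , _ , walk , _) u∈C v∈C with consec? u v C | consec? v u C
  ... | yes c | _     = cycle-edge cyc c
  ... | no _  | yes c = Connected∖-sym (Connected∖-swap (cycle-edge cyc c))
  ... | no ¬c | no ¬c′ = reach-within Adj∖-sym (¬consec⇒avoiding walk off-cycle) u∈C v∈C
    where
    off-cycle : ∀ {x y} → SameEnds u v x y → ¬ Consec g x y C
    off-cycle (inj₁ (refl , refl)) = ¬c
    off-cycle (inj₂ (refl , refl)) = ¬c′

  -- xs ++ [ v ] is a cycle closed by v ~ s, and v ∷ ys a path leaving it at v.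
  lollipop-bridge : ∀ xs {s t v w q ys} → Walk g s t (xs ++ v ∷ ys) → Unique (xs ++ v ∷ ys) →
                    v ~ s → 2 ≤ length xs → w ∈ xs → Bridge w q → q ∉ xs ++ v ∷ ys
  lollipop-bridge xs {v = v} {w} {q} {ys} walk uniq v~s len w∈xs wq q∈ =
    [ on-cycle , on-stick ]′ (∈-split xs q∈)
    where
    w∈C : w ∈ xs ++ [ v ]
    w∈C = ∈-++⁺ˡ w∈xs
    on-cycle : q ∉ xs ++ [ v ]
    on-cycle q∈C = wq (cycle-connected∖ (chord-cycle xs walk uniq v~s len) w∈C q∈C)
    on-stick : q ∉ v ∷ ys
    on-stick q∈stick with q ∈? xs ++ [ v ]
    ... | yes q∈C = on-cycle q∈C
    ... | no q∉C  = wq (reach-trans (withinʳ cycle q∉C w∈C (∈-++⁺ʳ xs (here refl)))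
                                    (withinˡ stick (Unique-++-disjoint xs uniq w∈xs) (here refl) q∈stick))
      where
      cycle = proj₁ (split-walk xs walk)
      stick = proj₂ (split-walk xs walk)

  distinct-orientations : ∀ {a b c d p₁ q₁ p₂ q₂} (a~b : a ~ b) (c~d : c ~ d) →
                          ¬ SameEdge g (edge a b a~b) (edge c d c~d) →
                          SameEnds a b p₁ q₁ → SameEnds c d p₂ q₂ → ¬ (p₁ ≡ p₂ × q₁ ≡ q₂)
  distinct-orientations _ _ e≢e′ (inj₁ (refl , refl)) (inj₁ (refl , refl)) (p , q) = e≢e′ (inj₁ (p , q))
  distinct-orientations _ _ e≢e′ (inj₁ (refl , refl)) (inj₂ (refl , refl)) (p , q) = e≢e′ (inj₂ (p , q))
  distinct-orientations _ _ e≢e′ (inj₂ (refl , refl)) (inj₁ (refl , refl)) (p , q) = e≢e′ (inj₂ (q , p))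
  distinct-orientations _ _ e≢e′ (inj₂ (refl , refl)) (inj₂ (refl , refl)) (p , q) = e≢e′ (inj₁ (q , p))

  record EdgesInOrder (s t a b c d : V) : Set where
    field
      a~b      : a ~ b
      c~d      : c ~ d
      a≢d      : a ≢ d
      s⇝c      : Connected∖ c d s c
      c⇝t      : Connected∖ a b c t
      middle   : List V
      b⇝c      : Walk g b c middle
      middle-unique : Unique middle
      a∉middle : a ∉ middle
      d∉middle : d ∉ middle

  edges-from-start : ∀ {p₁ q₁ p₂ q₂ t M} → Walk g p₁ t (p₁ ∷ q₁ ∷ M) → Unique (p₁ ∷ q₁ ∷ M) →
                     Consec g p₂ q₂ (q₁ ∷ M) → EdgesInOrder p₁ t p₁ q₁ p₂ q₂
  edges-from-start walk uniq = from-first (consec-adj walk now) (walk-tail walk) uniq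
    where
    from-first : ∀ {p₁ q₁ p₂ q₂ t L} → p₁ ~ q₁ → Walk g q₁ t L → Unique (p₁ ∷ L) → Consec g p₂ q₂ L →
            EdgesInOrder p₁ t p₁ q₁ p₂ q₂
    from-first {p₁} {q₁} {p₂} {q₂} p₁~q₁ walk (p₁∉ ∷ uniq) c with consec-split c
    ... | γ , δ , refl = record
      { a~b = p₁~q₁ ; c~d = consec-adj walk c ; a≢d = p₁≢q₂
      ; s⇝c = _ , avoidʳ (step p₁~q₁ (proj₁ halves)) q₂∉
      ; c⇝t = _ , avoidˡ (proj₂ halves) (p₁∉L ∘ ∈-++⁺ʳ γ)
      ; middle = γ ++ [ p₂ ] ; b⇝c = proj₁ halves ; middle-unique = proj₁ parts
      ; a∉middle = p₁∉L ∘ ∈-prefix γ ; d∉middle = q₂∉ ∘ there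
      }
      where
      halves = split-walk γ walk
      parts = Unique-split γ uniq
      p₁∉L : p₁ ∉ γ ++ p₂ ∷ q₂ ∷ δ
      p₁∉L = All¬⇒¬Any p₁∉
      p₁≢q₂ : p₁ ≢ q₂
      p₁≢q₂ refl = p₁∉L (∈-++⁺ʳ γ (there (here refl)))
      q₂∉ : q₂ ∉ p₁ ∷ γ ++ [ p₂ ]
      q₂∉ (here refl) = p₁≢q₂ refl
      q₂∉ (there q₂∈) with proj₂ (proj₂ parts) q₂∈ (there (here refl))
      ... | refl = Unique[x∷xs]⇒x∉xs (proj₁ (proj₂ parts)) (here refl)

  EdgesInOrder-prepend : ∀ {s s′ t a b c d} → s ~ s′ → s ≢ c × s ≢ d →
                         EdgesInOrder s′ t a b c d → EdgesInOrder s t a b c d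
  EdgesInOrder-prepend {s} {s′} {c = c} {d} s~s′ (s≢c , s≢d) o = record
    { a~b = a~b ; c~d = c~d ; a≢d = a≢d ; s⇝c = (s~s′ , ends) ▸ s⇝c ; c⇝t = c⇝t
    ; middle = middle ; b⇝c = b⇝c ; middle-unique = middle-unique
    ; a∉middle = a∉middle ; d∉middle = d∉middle
    }
    where
    open EdgesInOrder o
    ends : ¬ SameEnds c d s s′
    ends (inj₁ (s≡c , _)) = s≢c s≡c
    ends (inj₂ (s≡d , _)) = s≢d s≡d

  ∉⇒≢-consec : ∀ {s x y L} → s ∉ L → Consec g x y L → s ≢ x × s ≢ y
  ∉⇒≢-consec s∉L c = (λ { refl → s∉L (proj₁ (consec-∈ c)) }) , (λ { refl → s∉L (proj₂ (consec-∈ c)) })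

  edges-in-order : ∀ {s t π p₁ q₁ p₂ q₂} → Walk g s t π → Unique π →
                   Consec g p₁ q₁ π → Consec g p₂ q₂ π → ¬ (p₁ ≡ p₂ × q₁ ≡ q₂) →
                   EdgesInOrder s t p₁ q₁ p₂ q₂ ⊎ EdgesInOrder s t p₂ q₂ p₁ q₁
  edges-in-order _               _ now        now        distinct = ⊥-elim (distinct (refl , refl))
  edges-in-order walk@(step _ _) u now        (later c₂) _        = inj₁ (edges-from-start walk u c₂)
  edges-in-order walk@(step _ _) u (later c₁) now        _        = inj₂ (edges-from-start walk u c₁)
  edges-in-order (step r w) (s∉ ∷ u) (later c₁) (later c₂) distinct with edges-in-order w u c₁ c₂ distinct
  ... | inj₁ o = inj₁ (EdgesInOrder-prepend r (∉⇒≢-consec (All¬⇒¬Any s∉) c₂) o)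
  ... | inj₂ o = inj₂ (EdgesInOrder-prepend r (∉⇒≢-consec (All¬⇒¬Any s∉) c₁) o)

  neighbours : V → List V
  neighbours v = filterᵇ (Graph.adj g v) (allV n)

  ∈-neighbours⁺ : ∀ {v u} → v ~ u → u ∈ neighbours v
  ∈-neighbours⁺ {v} {u} = ∈-filter⁺ (T? ∘ Graph.adj g v) (∈-allFin u)

  ∈-neighbours⁻ : ∀ {v u} → u ∈ neighbours v → v ~ u
  ∈-neighbours⁻ {v} = proj₂ ∘ ∈-filter⁻ (T? ∘ Graph.adj g v) {xs = allFin n}

  neighbours-unique : ∀ v → Unique (neighbours v)
  neighbours-unique v = filter⁺ (T? ∘ Graph.adj g v) (allFin⁺ n)

  IsLeaf : V → Set
  IsLeaf v = degree g v ≡ 1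

  leaf-neighbour-unique : ∀ {v u u′} → IsLeaf v → v ~ u → v ~ u′ → u ≡ u′
  leaf-neighbour-unique {v} leaf v~u v~u′ = single (neighbours v) leaf (∈-neighbours⁺ v~u) (∈-neighbours⁺ v~u′)
    where
    single : ∀ {u u′} ws → length ws ≡ 1 → u ∈ ws → u′ ∈ ws → u ≡ u′
    single (_ ∷ []) _ (here refl) (here refl) = refl

  record OtherNeighbours (v p : V) : Set where
    field
      n₁ n₂ : V
      v~n₁  : v ~ n₁
      v~n₂  : v ~ n₂
      n₁≢p  : n₁ ≢ p
      n₂≢p  : n₂ ≢ p
      n₁≢n₂ : n₁ ≢ n₂

  other-neighbours : ∀ {v p} → degree g v ≡ 3 → v ~ p → OtherNeighbours v p
  other-neighbours {v} {p} deg3 v~p =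
    from-triple (neighbours v) deg3 (neighbours-unique v) (∈-neighbours⁺ v~p) ∈-neighbours⁻
    where
    from-triple : ∀ ws → length ws ≡ 3 → Unique ws → p ∈ ws → (∀ {u} → u ∈ ws → v ~ u) →
                  OtherNeighbours v p
    from-triple (w₁ ∷ w₂ ∷ w₃ ∷ []) _ ((w₁≢w₂ ∷ w₁≢w₃ ∷ []) ∷ (w₂≢w₃ ∷ []) ∷ _) p∈ adj with p∈
    ... | here refl = record
      { n₁ = w₂ ; n₂ = w₃ ; v~n₁ = adj (there (here refl)) ; v~n₂ = adj (there (there (here refl)))
      ; n₁≢p = w₁≢w₂ ∘ sym ; n₂≢p = w₁≢w₃ ∘ sym ; n₁≢n₂ = w₂≢w₃ }
    ... | there (here refl) = record
      { n₁ = w₁ ; n₂ = w₃ ; v~n₁ = adj (here refl) ; v~n₂ = adj (there (there (here refl)))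
      ; n₁≢p = w₁≢w₂ ; n₂≢p = w₂≢w₃ ∘ sym ; n₁≢n₂ = w₁≢w₃ }
    ... | there (there (here refl)) = record
      { n₁ = w₁ ; n₂ = w₂ ; v~n₁ = adj (here refl) ; v~n₂ = adj (there (here refl))
      ; n₁≢p = w₁≢w₃ ; n₂≢p = w₂≢w₃ ; n₁≢n₂ = w₁≢w₂ }

  third-neighbour : ∀ {v u₁ u₂} → degree g v ≡ 1 ⊎ degree g v ≡ 3 → v ~ u₁ → v ~ u₂ → u₁ ≢ u₂ →
                    ∃[ t ] v ~ t × t ≢ u₁ × t ≢ u₂
  third-neighbour (inj₁ leaf) v~u₁ v~u₂ u₁≢u₂ = ⊥-elim (u₁≢u₂ (leaf-neighbour-unique leaf v~u₁ v~u₂))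
  third-neighbour {u₂ = u₂} (inj₂ deg3) v~u₁ v~u₂ u₁≢u₂ = pick (n₁ ≟ u₂)
    where
    open OtherNeighbours (other-neighbours deg3 v~u₁)
    pick : Dec (n₁ ≡ u₂) → ∃[ t ] _ ~ t × t ≢ _ × t ≢ u₂
    pick (yes n₁≡u₂) = n₂ , v~n₂ , n₂≢p , λ n₂≡u₂ → n₁≢n₂ (trans n₁≡u₂ (sym n₂≡u₂))
    pick (no n₁≢u₂)  = n₁ , v~n₁ , n₁≢p , n₁≢u₂

  unique-length≤ : ∀ {L : List V} → Unique L → length L ≤ n
  unique-length≤ {L} u = subst (length L ≤_) (length-tabulate id) (unique⊆⇒length≤ u (λ {v} _ → ∈-allFin v))

  module OnTwoCuttable (two-cuttable : TwoCuttableGraph g) (connected : Connected g) where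

    open import Relation.Binary.PropositionalEquality using (setoid)
    open import Data.List.Relation.Binary.Permutation.Setoid (setoid V) using (_↭_; ↭-sym; ↭-trans; ↭-reflexive)
    open import Data.List.Relation.Binary.Permutation.Setoid.Properties (setoid V)
      using (++-comm; ∈-resp-↭; Unique-resp-↭; xs↭ys⇒|xs|≡|ys|)

    rotate↭ : ∀ i (C : List V) → rotate g i C ↭ C
    rotate↭ i C = ↭-trans (++-comm (drop i C) (take i C)) (↭-reflexive (take++drop≡id i C))

    first-two : ∀ (r : List V) k → 2 ≤ k → 2 ≤ length r → Unique r → All (IncidentToCutEdge g) (take k r) →
                ∃₂ λ u₁ u₂ → u₁ ∈ r × u₂ ∈ r × u₁ ≢ u₂ × IncidentToCutEdge g u₁ × IncidentToCutEdge g u₂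
    first-two (_ ∷ [])     _             _              (s≤s ()) _ _
    first-two (_ ∷ _ ∷ _)  (suc zero)    (s≤s ())       _        _ _
    first-two (u₁ ∷ u₂ ∷ _) (suc (suc _)) _             _        (u₁∉ ∷ _) (i₁ ∷ i₂ ∷ _) =
      u₁ , u₂ , here refl , there (here refl) , (λ u₁≡u₂ → All¬⇒¬Any u₁∉ (here u₁≡u₂)) , i₁ , i₂

    two-incident : ∀ {C} → IsCycle g C →
                   ∃₂ λ u₁ u₂ → u₁ ∈ C × u₂ ∈ C × u₁ ≢ u₂ × IncidentToCutEdge g u₁ × IncidentToCutEdge g u₂
    two-incident {C} cyc@(_ , _ , _ , _ , len , uniq) with two-cuttable C cyc
    ... | i , k , _ , 2≤k , _ , incident = back (first-two (rotate g i C) k 2≤k len′ uniq′ incident)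
      where
      rot = rotate↭ i C
      len′ = subst (2 ≤_) (sym (xs↭ys⇒|xs|≡|ys| rot)) (≤-trans (s≤s (s≤s z≤n)) len)
      uniq′ = Unique-resp-↭ (↭-sym rot) uniq
      back : (∃₂ λ u₁ u₂ → u₁ ∈ rotate g i C × u₂ ∈ rotate g i C × _) → ∃₂ λ u₁ u₂ → u₁ ∈ C × u₂ ∈ C × _
      back (u₁ , u₂ , u₁∈ , u₂∈ , rest) = u₁ , u₂ , ∈-resp-↭ rot u₁∈ , ∈-resp-↭ rot u₂∈ , rest

    incident⇒bridge : ∀ {w} → IncidentToCutEdge g w → ∃[ q ] w ~ q × Bridge w q
    incident⇒bridge (q , w~q , cut) = q , w~q , cut-edge⇒bridge connected w~q cut

    cycle-bridge-vertex : ∀ {C} → IsCycle g C → (b : V) → ∃[ w ] w ∈ C × w ≢ b × ∃[ q ] w ~ q × Bridge w q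
    cycle-bridge-vertex cyc b with two-incident cyc
    ... | u₁ , u₂ , u₁∈ , u₂∈ , u₁≢u₂ , inc₁ , inc₂ with u₁ ≟ b
    ...   | yes refl = u₂ , u₂∈ , u₁≢u₂ ∘ sym , incident⇒bridge inc₂
    ...   | no u₁≢b  = u₁ , u₁∈ , u₁≢b , incident⇒bridge inc₁

    -- The chord to the nearer vertex nA closes the cycle that two-cuttability is applied to;
    -- the chord to nB closes a larger one containing every path-neighbour of that cycle.
    chorded-path-bridge : ∀ {z y L α₀ α nA β nB} (b : V) → Walk g z y L → Unique L →
                          L ≡ z ∷ α₀ ∷ α ++ nA ∷ β → nA ~ z → nB ∈ β → nB ~ z →
                          ∃[ w ] w ∈ L × w ≢ b × w ≢ y × ∃[ q ] w ~ q × Bridge w q × q ∉ L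
    chorded-path-bridge {z} {y} {α₀ = α₀} {α} {nA} b walk uniq refl nA~z nB∈β nB~z with ∈-∃++ nB∈β
    ... | β₁ , β₂ , refl with cycle-bridge-vertex (chord-cycle (z ∷ α₀ ∷ α) walk uniq nA~z (s≤s (s≤s z≤n))) b
    ... | w , w∈C′ , w≢b , q , w~q , wq = w , w∈L , w≢b , w≢y , q , w~q , wq , q∉L
      where
      xs : List V
      xs = z ∷ α₀ ∷ α ++ nA ∷ β₁
      reshape : z ∷ α₀ ∷ α ++ nA ∷ β₁ ++ _ ≡ xs ++ _
      reshape = sym (++-assoc (z ∷ α₀ ∷ α) (nA ∷ β₁) _)
      walk′ = subst (Walk g z y) reshape walk
      uniq′ = subst Unique reshape uniq
      w∈xs : w ∈ xs
      w∈xs = ∈-prefix (z ∷ α₀ ∷ α) w∈C′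
      w∈L = subst (w ∈_) (sym reshape) (∈-++⁺ˡ w∈xs)
      w≢y : w ≢ y
      w≢y refl = Unique-++-disjoint xs uniq′ w∈xs (target∈ (proj₂ (split-walk xs walk′)))
      q∉L = lollipop-bridge xs walk′ uniq′ nB~z (s≤s (s≤s z≤n)) w∈xs wq ∘ subst (q ∈_) reshape

module _ {m : ℕ} {A B : Fin m → Bool} where

  SameSplit-sym : SameSplit A B → SameSplit B A
  SameSplit-sym (inj₁ A≗B)  = inj₁ (sym ∘ A≗B)
  SameSplit-sym (inj₂ A≗¬B) = inj₂ λ i → sym (trans (cong not (A≗¬B i)) (not-involutive (B i)))

  SameSplit-≢ : ∀ {i j} → SameSplit A B → A i ≢ A j → B i ≢ B j
  SameSplit-≢ {i} {j} (inj₁ A≗B)  Ai≢Aj Bi≡Bj = Ai≢Aj (trans (A≗B i) (trans Bi≡Bj (sym (A≗B j))))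
  SameSplit-≢ {i} {j} (inj₂ A≗¬B) Ai≢Aj Bi≡Bj =
    Ai≢Aj (trans (A≗¬B i) (trans (cong not Bi≡Bj) (sym (A≗¬B j))))

  crossing : ∀ {h k l} → SameSplit A B → A h ≡ A l → B h ≡ B k → A k ≡ A l
  crossing {h} {k} (inj₁ A≗B)  Ah≡Al Bh≡Bk =
    trans (A≗B k) (trans (sym Bh≡Bk) (trans (sym (A≗B h)) Ah≡Al))
  crossing {h} {k} (inj₂ A≗¬B) Ah≡Al Bh≡Bk =
    trans (A≗¬B k) (trans (cong not (sym Bh≡Bk)) (trans (sym (A≗¬B h)) Ah≡Al))

module Networks {m : ℕ} (U : Network m) (two-cuttable : TwoCuttable U) where

  open Network U
  open Graphs graph
  open OnTwoCuttable two-cuttable connected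
  open import Data.List.Membership.DecPropositional (_≟_ {n}) using (_∈?_)

  LeafBehind : V → V → Set
  LeafBehind x y = ∃[ ℓ ] IsLeaf ℓ × Connected∖ x y y ℓ

  LeafBeyond : V → V → V → V → Set
  LeafBeyond x y a b = ∃[ ℓ ] IsLeaf ℓ × Connected∖ x y y ℓ × Connected∖ a b y ℓ

  -- Since b lies behind the head, an edge from the head to x or to a would close a cycle
  -- through a bridge.
  record SearchState (x y a b : V) : Set where
    field
      head pred : V
      tail      : List V
      head~pred : head ~ pred
      tail-walk : Walk graph pred y tail
      unique    : Unique (head ∷ tail)
      x∉path    : x ∉ head ∷ tail
      a∉path    : a ∉ head ∷ tail
      b∈tail    : b ∈ tail

    path : List V
    path = head ∷ tail

    walk : Walk graph head y path
    walk = step head~pred tail-walk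

    head∉tail : head ∉ tail
    head∉tail = Unique[x∷xs]⇒x∉xs unique

    neighbour-in-tail : ∀ {v} → head ~ v → v ∈ path → v ∈ tail
    neighbour-in-tail head~v (here refl) = ⊥-elim (~⇒≢ head~v refl)
    neighbour-in-tail _      (there v∈)  = v∈

    not-adjacent : ∀ {c d} → Bridge c d → c ∉ path → d ∈ tail → ¬ head ~ c
    not-adjacent cd c∉ d∈ head~c =
      head∉tail (subst (_∈ tail) (sym head≡d) d∈)
      where head≡d = bridge-sole-neighbour cd walk c∉ (there d∈) (here refl) (~-sym head~c)

  extend : ∀ {x y a b} → Bridge x y → Bridge a b → (S : SearchState x y a b) →
           ∀ {v} → SearchState.head S ~ v → v ∉ SearchState.path S → SearchState x y a b
  extend xy ab S {v} head~v v∉ = record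
    { head = v ; pred = head ; tail = path ; head~pred = ~-sym head~v ; tail-walk = walk
    ; unique = ∷-unique v∉ unique
    ; x∉path = fresh xy x∉path (target∈ tail-walk) ; a∉path = fresh ab a∉path b∈tail
    ; b∈tail = there b∈tail
    }
    where
    open SearchState S
    fresh : ∀ {c d} → Bridge c d → c ∉ path → d ∈ tail → c ∉ v ∷ path
    fresh cd c∉ d∈ (here refl) = not-adjacent cd c∉ d∈ head~v
    fresh cd c∉ d∈ (there c∈)  = c∉ c∈

  record Jump (x y a b : V) : Set where
    field
      state  : SearchState x y a b
      w q    : V
      w∈path : w ∈ SearchState.path state
      w~q    : w ~ q
      wq     : Bridge w q
      q∉path : q ∉ SearchState.path state
      q≢x    : q ≢ x
      q≢a    : q ≢ a

  jump : ∀ {x y a b} → Bridge x y → Bridge a b → (S : SearchState x y a b) → ∀ {α nA β nB} →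
         SearchState.tail S ≡ α ++ nA ∷ β → nA ≢ SearchState.pred S → nB ∈ β →
         SearchState.head S ~ nA → SearchState.head S ~ nB → Jump x y a b
  jump xy ab S {[]} eq nA≢pred _ _ _ =
    ⊥-elim (nA≢pred (sym (source≡head (subst (Walk graph _ _) eq (SearchState.tail-walk S)))))
  jump {b = b} xy ab S {α₀ ∷ α} eq _ nB∈β head~nA head~nB
    with chorded-path-bridge b (SearchState.walk S) (SearchState.unique S)
           (cong (SearchState.head S ∷_) eq) (~-sym head~nA) nB∈β (~-sym head~nB)
  ... | w , w∈ , w≢b , w≢y , q , w~q , wq , q∉ = record
    { state = S ; w∈path = w∈ ; w~q = w~q ; wq = wq ; q∉path = q∉
    ; q≢x = λ { refl → w≢y (bridge-sole-neighbour xy walk x∉path (target∈ walk) w∈ (~-sym w~q)) }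
    ; q≢a = λ { refl → w≢b (bridge-sole-neighbour ab walk a∉path (there b∈tail) w∈ (~-sym w~q)) }
    }
    where open SearchState S

  search-step : ∀ {x y a b} → Bridge x y → Bridge a b → (S : SearchState x y a b) →
                LeafBeyond x y a b ⊎ Jump x y a b ⊎
                ∃[ v ] SearchState.head S ~ v × v ∉ SearchState.path S
  search-step {x} {y} {a} {b} xy ab S = by-degree (deg13 head)
    where
    open SearchState S
    Outcome = LeafBeyond x y a b ⊎ Jump x y a b ⊎ ∃[ v ] head ~ v × v ∉ path
    by-degree : IsLeaf head ⊎ degree graph head ≡ 3 → Outcome
    by-degree (inj₁ leaf) =
      inj₁ (head , leaf , withinˡ walk x∉path (target∈ walk) (here refl)
                        , withinˡ walk a∉path (target∈ walk) (here refl))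
    by-degree (inj₂ deg3) = by-membership (n₁ ∈? path) (n₂ ∈? path)
      where
      open OtherNeighbours (other-neighbours deg3 head~pred)
      chords : ∃₂ (λ α β → (tail ≡ α ++ n₁ ∷ β × n₂ ∈ β) ⊎ (tail ≡ α ++ n₂ ∷ β × n₁ ∈ β)) → Jump x y a b
      chords (_ , _ , inj₁ (eq , n₂∈β)) = jump xy ab S eq n₁≢p n₂∈β v~n₁ v~n₂
      chords (_ , _ , inj₂ (eq , n₁∈β)) = jump xy ab S eq n₂≢p n₁∈β v~n₂ v~n₁
      by-membership : Dec (n₁ ∈ path) → Dec (n₂ ∈ path) → Outcome
      by-membership (no n₁∉)  _         = inj₂ (inj₂ (n₁ , v~n₁ , n₁∉))
      by-membership (yes _)   (no n₂∉)  = inj₂ (inj₂ (n₂ , v~n₂ , n₂∉))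
      by-membership (yes n₁∈) (yes n₂∈) =
        inj₂ (inj₁ (chords (first-of tail (neighbour-in-tail v~n₁ n₁∈) (neighbour-in-tail v~n₂ n₂∈) n₁≢n₂)))

  search : ∀ {x y a b} → Bridge x y → Bridge a b → ∀ fuel (S : SearchState x y a b) →
           n < length (SearchState.path S) + fuel → LeafBeyond x y a b ⊎ Jump x y a b
  search xy ab zero S bound =
    ⊥-elim (<⇒≱ (subst (n <_) (+-identityʳ _) bound) (unique-length≤ (SearchState.unique S)))
  search xy ab (suc fuel) S bound with search-step xy ab S
  ... | inj₁ found                    = inj₁ found
  ... | inj₂ (inj₁ J)                 = inj₂ J
  ... | inj₂ (inj₂ (v , head~v , v∉)) =
    search xy ab fuel (extend xy ab S head~v v∉) (subst (n <_) (+-suc _ fuel) bound)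

  search-from : ∀ {x y a b} → Bridge x y → Bridge a b → SearchState x y a b → LeafBeyond x y a b ⊎ Jump x y a b
  search-from xy ab S = search xy ab n S (s≤s (m≤n+m n _))

  jump-beyond : ∀ {x y a b} (J : Jump x y a b) → LeafBehind (Jump.w J) (Jump.q J) → LeafBeyond x y a b
  jump-beyond J (ℓ , leaf , q⇝ℓ) =
    ℓ , leaf , beyond-bridge walk w∈path q∉path w~q wq x∉path (target∈ walk) q≢x q⇝ℓ
             , beyond-bridge walk w∈path q∉path w~q wq a∉path (there b∈tail) q≢a q⇝ℓ
    where
    open Jump J
    open SearchState state

  pendant-start : ∀ {x y} → x ~ y → degree graph y ≡ 3 → SearchState x y x y
  pendant-start {x} {y} x~y deg3 = record
    { head = n₁ ; pred = y ; tail = [ y ] ; head~pred = ~-sym v~n₁ ; tail-walk = here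
    ; unique = ∷-unique n₁∉ ([] ∷ []) ; x∉path = x∉ ; a∉path = x∉ ; b∈tail = here refl
    }
    where
    open OtherNeighbours (other-neighbours deg3 (~-sym x~y))
    n₁∉ : n₁ ∉ [ y ]
    n₁∉ (here n₁≡y) = ~⇒≢ v~n₁ (sym n₁≡y)
    x∉ : x ∉ n₁ ∷ [ y ]
    x∉ (here x≡n₁)         = n₁≢p (sym x≡n₁)
    x∉ (there (here x≡y)) = ~⇒≢ x~y x≡y

  -- O collects vertices known to lie off y's side of xy; each jump adds the whole path.
  pendant-leaf′ : ∀ fuel (O : List V) {x y} → n < length O + fuel → Unique O →
                  (∀ {o} → o ∈ O → ¬ Connected∖ x y y o) → x ~ y → Bridge x y → LeafBehind x y
  pendant-leaf′ zero O bound uO _ _ _ =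
    ⊥-elim (<⇒≱ (subst (n <_) (+-identityʳ _) bound) (unique-length≤ uO))
  pendant-leaf′ (suc fuel) O {x} {y} bound uO outside x~y xy with deg13 y
  ... | inj₁ leaf = y , leaf , reach-refl
  ... | inj₂ deg3 with search-from xy xy (pendant-start x~y deg3)
  ...   | inj₁ (ℓ , leaf , y⇝ℓ , _) = ℓ , leaf , y⇝ℓ
  ...   | inj₂ J = first (jump-beyond J (pendant-leaf′ fuel (O ++ path) (<-step O fuel bound)
                                           (++⁺ uO unique disjoint) outside′ w~q wq))
    where
    open Jump J
    open SearchState state
    first : LeafBeyond x y x y → LeafBehind x y
    first (ℓ , leaf , y⇝ℓ , _) = ℓ , leaf , y⇝ℓ
    disjoint : ∀ {o} → ¬ (o ∈ O × o ∈ path)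
    disjoint (o∈O , o∈path) = outside o∈O (withinˡ walk x∉path (target∈ walk) o∈path)
    outside′ : ∀ {o} → o ∈ O ++ path → ¬ Connected∖ w q q o
    outside′ o∈ q⇝o with ∈-++⁻ O o∈
    ... | inj₁ o∈O    = outside o∈O (beyond-bridge walk w∈path q∉path w~q wq x∉path (target∈ walk) q≢x q⇝o)
    ... | inj₂ o∈path = wq (Connected∖-sym (reach-trans q⇝o (withinʳ walk q∉path o∈path w∈path)))

  pendant-leaf : ∀ {x y} → x ~ y → Bridge x y → LeafBehind x y
  pendant-leaf = pendant-leaf′ (suc n) [] ≤-refl [] (λ ())

  middle-state : ∀ {s t a b c d} → Bridge c d → EdgesInOrder s t a b c d → SearchState d c a b
  middle-state {a = a} {c = c} {d = d} cd o = from-middle b⇝c middle-unique a∉middle d∉middle (~-sym a~b)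
    where
    open EdgesInOrder o
    start : ∀ {b h L} → b ~ h → Walk graph b c (b ∷ L) → Unique (h ∷ b ∷ L) →
            d ∉ h ∷ b ∷ L → a ∉ h ∷ b ∷ L → SearchState d c a b
    start b~h walk uniq d∉ a∉ = record
      { head~pred = ~-sym b~h ; tail-walk = walk ; unique = uniq
      ; x∉path = d∉ ; a∉path = a∉ ; b∈tail = here refl
      }
    from-middle : ∀ {b M} → Walk graph b c M → Unique M → a ∉ M → d ∉ M → b ~ a → SearchState d c a b
    from-middle here _ a∉ d∉ b~a with third-neighbour (deg13 _) b~a c~d a≢d
    ... | h , b~h , h≢a , h≢d =
      start b~h here (∷-unique (∉-∷ (~⇒≢ b~h ∘ sym) λ ()) ([] ∷ [])) (∉-∷ (h≢d ∘ sym) d∉) (∉-∷ (h≢a ∘ sym) a∉)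
    from-middle walk@(step {y = s} b~s s⇝c) uniq@(b∉ ∷ uniq′) a∉ d∉ b~a
      with third-neighbour (deg13 _) b~a b~s (λ { refl → a∉ (there (source∈ s⇝c)) })
    ... | h , b~h , h≢a , h≢s with h ∈? _
    ...   | no h∉ = start b~h walk (∷-unique (∉-∷ (~⇒≢ b~h ∘ sym) h∉) uniq) (∉-∷ d≢h d∉) (∉-∷ (h≢a ∘ sym) a∉)
      where
      d≢h : d ≢ h
      d≢h refl = All¬⇒¬Any b∉ (subst (_∈ _) (sym b≡c) (target∈ s⇝c))
        where b≡c = bridge-sole-neighbour (Bridge-sym cd) walk d∉ (target∈ walk) (here refl) (~-sym b~h)
    -- h is on the middle path already: shortcut it through h, making b's successor s fresh.
    ...   | yes h∈ with suffix s⇝c h∈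
    ...     | pre , L′ , refl , h⇝c =
      start b~s (step b~h h⇝c)
            (∷-unique (∉-∷ (~⇒≢ b~s ∘ sym) (s∉L′ pre s⇝c uniq′))
                      (∷-unique (All¬⇒¬Any b∉ ∘ ∈-++⁺ʳ pre) (Unique-++⁻ʳ pre uniq′)))
            (d∉ ∘ shortcut⊆) (a∉ ∘ shortcut⊆)
      where
      s∉L′ : ∀ pre → Walk graph s _ (pre ++ L′) → Unique (pre ++ L′) → s ∉ L′
      s∉L′ []         s⇝c _         _   = h≢s (same-source h⇝c s⇝c)
      s∉L′ (p₀ ∷ pre) s⇝c (p₀∉ ∷ _) s∈L′ =
        All¬⇒¬Any p₀∉ (subst (_∈ pre ++ L′) (source≡head s⇝c) (∈-++⁺ʳ pre s∈L′))
      shortcut⊆ : ∀ {u} → u ∈ s ∷ _ ∷ L′ → u ∈ _ ∷ pre ++ L′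
      shortcut⊆ (here refl)         = there (source∈ s⇝c)
      shortcut⊆ (there (here refl)) = here refl
      shortcut⊆ (there (there u∈))  = there (∈-++⁺ʳ pre u∈)

  middle-leaf : ∀ {s t a b c d} → EdgesInOrder s t a b c d → Bridge a b → Bridge c d → LeafBeyond d c a b
  middle-leaf o ab cd with search-from (Bridge-sym cd) ab (middle-state cd o)
  ... | inj₁ found = found
  ... | inj₂ J     = jump-beyond J (pendant-leaf (Jump.w~q J) (Jump.wq J))

  leaf-between : ∀ {s t a b c d} → EdgesInOrder s t a b c d → Bridge a b → Bridge c d →
                 ∃[ ℓ ] IsLeaf ℓ × Connected∖ a b ℓ t × Connected∖ c d ℓ s
  leaf-between o ab cd with middle-leaf o ab cd
  ... | ℓ , leaf , c⇝ℓ∖dc , c⇝ℓ∖ab =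
    ℓ , leaf , reach-trans (Connected∖-sym c⇝ℓ∖ab) c⇝t
             , reach-trans (Connected∖-sym (Connected∖-swap c⇝ℓ∖dc)) (Connected∖-sym s⇝c)
    where open EdgesInOrder o

  ConstantOnSides : V → V → (Fin m → Bool) → Set
  ConstantOnSides p q A = ∀ {k l} → Connected∖ p q (leaf k) (leaf l) → A k ≡ A l

  ConstantOnSides-transport : ∀ {a b p q A} → SameEnds a b p q → ConstantOnSides a b A → ConstantOnSides p q A
  ConstantOnSides-transport ends constant = constant ∘ Connected∖-transport ends

  induced-split-separates : ∀ {a b} (a~b : a ~ b) {A k l} → Induces U (edge a b a~b) A →
                            A k ≡ true → A l ≡ false → ¬ Connected∖ a b (leaf k) (leaf l)
  induced-split-separates _ {k = k} {l} (_ , separates) Ak Al (_ , walk) with to-path walk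
  ... | π , path , uniq =
    [ avoiding⇒¬consec path (inj₁ (refl , refl)) , avoiding⇒¬consec path (inj₂ (refl , refl)) ]′
      (separates k l Ak Al π (map-walk proj₁ path , uniq))

  induced-constant : ∀ {a b} (a~b : a ~ b) {A} → Induces U (edge a b a~b) A → ConstantOnSides a b A
  induced-constant a~b {A} iA {k} {l} conn with A k in Ak | A l in Al
  ... | true  | true  = refl
  ... | false | false = refl
  ... | true  | false = ⊥-elim (induced-split-separates a~b iA Ak Al conn)
  ... | false | true  = ⊥-elim (induced-split-separates a~b iA Al Ak (Connected∖-sym conn))

  split-witnesses : ∀ {A} → IsSplit U A → ∃₂ λ i j → A i ≢ A j
  split-witnesses ((i , Ai) , (j , Aj)) = i , j , λ Ai≡Aj → true≢false (trans (sym Ai) (trans Ai≡Aj Aj))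
    where
    true≢false : true ≢ false
    true≢false ()

  crossed-by : ∀ {a b A k l π} → ConstantOnSides a b A → A k ≢ A l → Walk graph (leaf k) (leaf l) π →
               ∃₂ λ p q → SameEnds a b p q × Consec graph p q π
  crossed-by {a} {b} {π = π} constant Ak≢Al walk with consec? a b π | consec? b a π
  ... | yes c | _      = a , b , inj₁ (refl , refl) , c
  ... | no _  | yes c  = b , a , inj₂ (refl , refl) , c
  ... | no ¬c | no ¬c′ = ⊥-elim (Ak≢Al (constant (_ , ¬consec⇒avoiding walk avoid)))
    where
    avoid : ∀ {x y} → SameEnds a b x y → ¬ Consec graph x y π
    avoid (inj₁ (refl , refl)) = ¬c
    avoid (inj₂ (refl , refl)) = ¬c′

  cut-edge-on-path : ∀ {a b} (a~b : a ~ b) {A k l π} → IsCutEdge graph (edge a b a~b) →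
                     Induces U (edge a b a~b) A → A k ≢ A l → Walk graph (leaf k) (leaf l) π →
                     ∃₂ λ p q → SameEnds a b p q × Consec graph p q π × Bridge p q × ConstantOnSides p q A
  cut-edge-on-path a~b cut iA Ak≢Al walk with crossed-by (induced-constant a~b iA) Ak≢Al walk
  ... | p , q , ends , on-path =
    p , q , ends , on-path , Bridge-transport ends (cut-edge⇒bridge connected a~b cut)
                           , ConstantOnSides-transport ends (induced-constant a~b iA)

  same-split⇒ends-agree : ∀ {k l p₁ q₁ p₂ q₂ A B} → EdgesInOrder (leaf k) (leaf l) p₁ q₁ p₂ q₂ →
                          Bridge p₁ q₁ → Bridge p₂ q₂ → ConstantOnSides p₁ q₁ A → ConstantOnSides p₂ q₂ B →
                          SameSplit A B → A k ≡ A l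
  same-split⇒ends-agree o bridge₁ bridge₂ A-constant B-constant A≈B with leaf-between o bridge₁ bridge₂
  ... | ℓ , is-leaf , ℓ⇝l , ℓ⇝k with leaf-surj ℓ is-leaf
  ...   | h , refl = crossing A≈B (A-constant ℓ⇝l) (B-constant ℓ⇝k)

lemma5 : {m : ℕ} (U : Network m) → TwoCuttable U →
    (e e' : Cut U) → CutEdge U e → CutEdge U e' →
    ¬ SameEdge (Network.graph U) e e' →
    (A B : Fin m → Bool) → Induces U e A → Induces U e' B →
    ¬ SameSplit A B
lemma5 U tc (edge a b a~b) (edge c d c~d) ab-cut cd-cut e≢e′ A B iA iB A≈B =
  let (i , j , Ai≢Aj)   = split-witnesses (proj₁ iA)
      Bi≢Bj             = SameSplit-≢ A≈B Ai≢Aj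
      (π , walk , uniq) = to-path (proj₂ (connected (leaf i) (leaf j)))
      (p₁ , q₁ , ends₁ , on₁ , bridge₁ , A-constant) = cut-edge-on-path a~b ab-cut iA Ai≢Aj walk
      (p₂ , q₂ , ends₂ , on₂ , bridge₂ , B-constant) = cut-edge-on-path c~d cd-cut iB Bi≢Bj walk
  in [ (λ e-first  → Ai≢Aj (same-split⇒ends-agree e-first bridge₁ bridge₂ A-constant B-constant A≈B))
     , (λ e′-first → Bi≢Bj (same-split⇒ends-agree e′-first bridge₂ bridge₁ B-constant A-constant
                                                     (SameSplit-sym A≈B)))
     ]′ (edges-in-order walk uniq on₁ on₂ (distinct-orientations a~b c~d e≢e′ ends₁ ends₂))
  where
  open Network U
  open Graphs graph
  open Networks U tc
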